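{- For every $n\ge 1$, the map $\Phi$ restricts to a bijection from $\Pi_n(13/2,\,123)$ onto $S_n(123,\,132,\,213)$.
   Context: $\Pi_n$ is the set of set partitions of $[n]=\{1,\dots,n\}$, written $B_1/B_2/\cdots/B_k$ with blocks in canonical order $\min B_1<\cdots<\min B_k$ and elements of each block listed increasingly. For $\pi\in\Pi_m$, $\sigma\in\Pi_n$ contains the partition pattern $\pi$ if there is $S\subseteq[n]$, $\#S=m$, such that $\{B\cap S: B\in\sigma,\ B\cap S\ne\emptyset\}$ relabeled by the order-preserving bijection $S\to[m]$ equals $\pi$; otherwise it avoids $\pi$; $\Pi_n(R)$ is the set of $\sigma\in\Pi_n$ avoiding all patterns in $R$. $S_n$ is the set of permutations of $[n]$ in one-line notation $q=b_1\cdots b_n$; $q$ contains $p\in S_k$ if some subsequence $b_{i_1}\cdots b_{i_k}$ ($i_1<\dots<i_k$) is order-isomorphic to $p$, otherwise $q$ avoids $p$; $S_n(R)$ is the set of permutations in $S_n$ avoiding every pattern in $R$. The map $\Phi:\Pi_n\to S_n$ sends $\sigma=B_1/B_2/\cdots/B_k$ to the word $B_kB_{k-1}\cdots B_1$ obtained by concatenating the blocks in reverse order, each listed increasingly; e.g. $\Phi(1/23/4/56)=564231$. -}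

module Defs where

open import Data.Nat using (ℕ; zero; suc; _<_)
open import Data.Fin using (Fin; toℕ; cast)
open import Data.List using (List; []; _∷_; map; concat; reverse; upTo; length; lookup)
open import Data.List.Relation.Unary.All using (All)
open import Data.List.Relation.Unary.Linked using (Linked)
open import Data.List.Relation.Binary.Permutation.Propositional using (_↭_)
open import Data.List.Relation.Binary.Sublist.Propositional using (_⊆_)
open import Data.List.Membership.Propositional using (_∈_)
open import Data.Product using (Σ; ∃; _×_)
open import Data.Empty using (⊥)
open import Function.Bundles using (_⇔_)
open import Relation.Nullary using (¬_)
open import Relation.Binary.PropositionalEquality using (_≡_; _≢_)

[1‥_] : ℕ → List ℕ
[1‥ n ] = map suc (upTo n)

-- canonical order of consecutive blocks: min B < min C (blocks listed increasingly)
_◃_ : List ℕ → List ℕ → Set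
(x ∷ _) ◃ (y ∷ _) = x < y
_       ◃ _       = ⊥

-- σ ∈ Π_n : nonempty blocks, each listed increasingly, blocks in canonical
-- order, and the blocks are pairwise disjoint with union [n]
-- (concatenation is a rearrangement of 1,…,n).
record IsSetPartition (n : ℕ) (σ : List (List ℕ)) : Set where
  field
    nonempty   : All (λ B → B ≢ []) σ
    increasing : All (Linked _<_) σ
    canonical  : Linked _◃_ σ
    covers     : concat σ ↭ [1‥ n ]

SameBlock : List (List ℕ) → ℕ → ℕ → Set
SameBlock σ x y = ∃ λ B → B ∈ σ × x ∈ B × y ∈ B

-- σ ∈ Π_n contains π ∈ Π_m: there is S ⊆ [n] with #S = m (S listed increasingly,
-- i.e. a sublist of 1,…,n) such that the restriction of σ to S, relabelled by the
-- order-preserving bijection S → [m] (i-th element of S ↦ i), equals π; equality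
-- of set partitions is expressed as equality of their "same block" relations.
PContains : (n : ℕ) (σ : List (List ℕ)) (m : ℕ) (π : List (List ℕ)) → Set
PContains n σ m π =
  Σ (List ℕ) λ S → S ⊆ [1‥ n ] × Σ (length S ≡ m) λ _ →
    ∀ (i j : Fin (length S)) →
      SameBlock σ (lookup S i) (lookup S j) ⇔ SameBlock π (suc (toℕ i)) (suc (toℕ j))

IsPerm : ℕ → List ℕ → Set
IsPerm n q = q ↭ [1‥ n ]

OrderIso : List ℕ → List ℕ → Set
OrderIso xs ys = Σ (length xs ≡ length ys) λ eq →
  ∀ (i j : Fin (length xs)) →
    (lookup xs i < lookup xs j) ⇔ (lookup ys (cast eq i) < lookup ys (cast eq j))

Contains : List ℕ → List ℕ → Set
Contains q p = ∃ λ ys → ys ⊆ q × OrderIso ys p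

p13/2 : List (List ℕ)
p13/2 = (1 ∷ 3 ∷ []) ∷ (2 ∷ []) ∷ []

p123ᴾ : List (List ℕ)
p123ᴾ = (1 ∷ 2 ∷ 3 ∷ []) ∷ []

p123 p132 p213 : List ℕ
p123 = 1 ∷ 2 ∷ 3 ∷ []
p132 = 1 ∷ 3 ∷ 2 ∷ []
p213 = 2 ∷ 1 ∷ 3 ∷ []

InΠ : ℕ → List (List ℕ) → Set
InΠ n σ = IsSetPartition n σ × ¬ PContains n σ 3 p13/2 × ¬ PContains n σ 3 p123ᴾ

InS : ℕ → List ℕ → Set
InS n q = IsPerm n q × ¬ Contains q p123 × ¬ Contains q p132 × ¬ Contains q p213

Φ : List (List ℕ) → List ℕ
Φ σ = concat (reverse σ)

{-# OPTIONS --safe #-}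
-- Avoiding 13/2 forces every ascent x < y of the word Φ σ into a single block: otherwise y lies
-- in an earlier block C, and min C, x, y form 13/2.  Each of 123, 132 and 213 has two ascents
-- sharing a letter, so an occurrence would put three letters into one block, an occurrence of
-- the partition pattern 123.
-- Φ is injective on all set partitions: reading Φ σ from the left, a block ends exactly where
-- the word first drops below the block's first letter.
-- Conversely, a permutation of [1‥ n] avoiding 123, 132 and 213 starts with n, or with n-1
-- followed by n; peeling these letters off recursively exhibits it as Φ of a tiling of [1‥ n]
-- by blocks {k} and {k, k+1}, and a partition without gaps in its blocks avoids 13/2 and 123.
module Submission where

open import Defs
open import Relation.Binary.PropositionalEquality
  using (_≡_; _≢_; refl; sym; trans; cong; subst; ≢-sym; setoid; module ≡-Reasoning)
open import Data.Nat using (ℕ; zero; suc; _≤_; _<_; z≤n; s≤s; z<s; s<s; _≟_)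
open import Data.Nat.Properties
  using ( <-trans; <-irrefl; <⇒≢; >⇒≢; <⇒≤; <⇒≱; ≤-refl; ≤-trans; ≤-<-trans; <-≤-trans
        ; n≤1+n; n<1+n; m<n⇒m<1+n; m<1+n⇒m≤n; m≤n⇒m<n∨m≡n; ≤∧≢⇒<)
open import Data.Fin using (Fin; zero; suc; toℕ; cast)
open import Data.List
  using (List; []; _∷_; [_]; _++_; map; concat; reverse; upTo; head; lookup)
open import Data.List.Properties
  using ( upTo-∷ʳ; map-++; concat-++; ++-identityʳ; ++-assoc; unfold-reverse; reverse-++
        ; reverse-injective; ∷-injective)
open import Data.List.Relation.Unary.All as All using (All; []; _∷_)
import Data.List.Relation.Unary.All.Properties as All
open import Data.List.Relation.Unary.Any using (here; there)
open import Data.List.Relation.Unary.Any.Properties using (reverse⁻)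
open import Data.List.Relation.Unary.AllPairs as AllPairs using (AllPairs; []; _∷_)
import Data.List.Relation.Unary.AllPairs.Properties as AllPairs
open import Data.List.Relation.Unary.Linked as Linked using (Linked; []; [-]; _∷_)
open import Data.List.Relation.Unary.Linked.Properties
  using (AllPairs⇒Linked; Linked⇒AllPairs; Linked⇒All)
open import Data.List.Relation.Unary.Unique.Propositional using (Unique)
open import Data.List.Relation.Binary.Permutation.Propositional
  using (_↭_; refl; prep; swap; ↭-sym; ↭-trans; ↭-reflexive; ↭⇒↭ₛ; module PermutationReasoning)
open import Data.List.Relation.Binary.Permutation.Propositional.Properties
  using (∈-resp-↭; All-resp-↭; ↭-empty-inv; ↭-length; ↭-reverse; ++⁺ˡ; ++⁺ʳ; ++-comm; drop-∷; shift)
open import Data.List.Relation.Binary.Permutation.Setoid.Properties (setoid ℕ) using (Unique-resp-↭)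
open import Data.List.Relation.Binary.Sublist.Propositional
  using (_⊆_; []; _∷_; _∷ʳ_; ⊆-refl; ⊆-trans; minimum; from∈; to∈) renaming (lookup to ⊆-lookup)
open import Data.List.Relation.Binary.Sublist.Propositional.Properties using (All-resp-⊆)
open import Data.List.Membership.Propositional using (_∈_; _∉_)
open import Data.List.Membership.Propositional.Properties
  using (∈-++⁻; ∈-++⁺ʳ; ∈-concat⁺′; ∈-concat⁻′; ∈-map⁺; ∈-map⁻; ∈-upTo⁺; ∈-upTo⁻)
open import Data.Maybe.Relation.Unary.All as Maybe using (just; nothing)
open import Data.Product using (Σ; ∃; ∃₂; _×_; _,_; proj₁; proj₂)
open import Data.Sum as Sum using (_⊎_; inj₁; inj₂)
open import Data.Empty using (⊥; ⊥-elim)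
open import Function using (id; const; flip; _∘_)
open import Function.Bundles using (_⇔_; mk⇔; Equivalence)
open import Relation.Nullary using (¬_; yes; no)

[1‥]-∷ʳ : ∀ n → [1‥ suc n ] ≡ [1‥ n ] ++ [ suc n ]
[1‥]-∷ʳ n = begin
  map suc (upTo (suc n))     ≡⟨ cong (map suc) (upTo-∷ʳ n) ⟨
  map suc (upTo n ++ [ n ])  ≡⟨ map-++ suc (upTo n) [ n ] ⟩
  [1‥ n ] ++ [ suc n ]       ∎
  where open ≡-Reasoning

[1‥]-++-pair : ∀ k → [1‥ k ] ++ suc k ∷ suc (suc k) ∷ [] ≡ [1‥ suc (suc k) ]
[1‥]-++-pair k = begin
  [1‥ k ] ++ suc k ∷ suc (suc k) ∷ []        ≡⟨ ++-assoc [1‥ k ] [ suc k ] [ suc (suc k) ] ⟨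
  ([1‥ k ] ++ [ suc k ]) ++ [ suc (suc k) ]  ≡⟨ cong (_++ [ suc (suc k) ]) ([1‥]-∷ʳ k) ⟨
  [1‥ suc k ] ++ [ suc (suc k) ]             ≡⟨ [1‥]-∷ʳ (suc k) ⟨
  [1‥ suc (suc k) ]                          ∎
  where open ≡-Reasoning

[1‥]-sorted : ∀ n → AllPairs _<_ [1‥ n ]
[1‥]-sorted n = AllPairs.map⁺ (AllPairs.applyUpTo⁺₁ id n (λ i<j _ → s<s i<j))

∈-[1‥]⁻ : ∀ {x n} → x ∈ [1‥ n ] → 1 ≤ x × x ≤ n
∈-[1‥]⁻ x∈ with _ , i∈ , refl ← ∈-map⁻ suc x∈ = s≤s z≤n , ∈-upTo⁻ i∈

∈-[1‥]⁺ : ∀ {x n} → 1 ≤ x → x ≤ n → x ∈ [1‥ n ]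
∈-[1‥]⁺ (s≤s z≤n) i<n = ∈-map⁺ suc (∈-upTo⁺ i<n)

↭-[1‥]⇒Unique : ∀ {n q} → q ↭ [1‥ n ] → Unique q
↭-[1‥]⇒Unique {n} q↭ = Unique-resp-↭ (↭⇒↭ₛ (↭-sym q↭)) (AllPairs.map <⇒≢ ([1‥]-sorted n))

module _ {A : Set} where

  ∈-tail : ∀ {x y : A} {ys} → x ∈ y ∷ ys → x ≢ y → x ∈ ys
  ∈-tail (here x≡y) x≢y = ⊥-elim (x≢y x≡y)
  ∈-tail (there x∈) _   = x∈

  All-reverse : ∀ {P : A → Set} {xs} → All P xs → All P (reverse xs)
  All-reverse {xs = xs} = All-resp-↭ (↭-sym (↭-reverse xs))

  AllPairs-reverse : ∀ {R : A → A → Set} {xs} → AllPairs R xs → AllPairs (flip R) (reverse xs)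
  AllPairs-reverse {xs = []}     []         = []
  AllPairs-reverse {xs = x ∷ xs} (px ∷ pxs) rewrite unfold-reverse x xs =
    AllPairs.++⁺ (AllPairs-reverse pxs) ([] ∷ []) (All.map (_∷ []) (All-reverse px))

  AllPairs-resp-⊆ : ∀ {R : A → A → Set} {xs ys} → xs ⊆ ys → AllPairs R ys → AllPairs R xs
  AllPairs-resp-⊆ []           []         = []
  AllPairs-resp-⊆ (_ ∷ʳ xs⊆)   (_ ∷ pys)  = AllPairs-resp-⊆ xs⊆ pys
  AllPairs-resp-⊆ (refl ∷ xs⊆) (py ∷ pys) = All-resp-⊆ xs⊆ py ∷ AllPairs-resp-⊆ xs⊆ pys

  AllPairs-pair : ∀ {R : A → A → Set} {x y zs} → AllPairs R zs → x ∷ y ∷ [] ⊆ zs → R x y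
  AllPairs-pair pzs s with (Rxy ∷ []) ∷ _ ← AllPairs-resp-⊆ s pzs = Rxy

  distinct-∈⇒⊆ : ∀ {x y : A} {zs} → x ∈ zs → y ∈ zs → x ≢ y →
                 x ∷ y ∷ [] ⊆ zs ⊎ y ∷ x ∷ [] ⊆ zs
  distinct-∈⇒⊆ (here refl) (here refl) x≢y = ⊥-elim (x≢y refl)
  distinct-∈⇒⊆ (here refl) (there y∈)  _   = inj₁ (refl ∷ from∈ y∈)
  distinct-∈⇒⊆ (there x∈)  (here refl) _   = inj₂ (refl ∷ from∈ x∈)
  distinct-∈⇒⊆ (there x∈)  (there y∈)  x≢y = Sum.map (_ ∷ʳ_) (_ ∷ʳ_) (distinct-∈⇒⊆ x∈ y∈ x≢y)

  pair-⊆-++ : ∀ {x y : A} xs {ys} → x ∷ y ∷ [] ⊆ xs ++ ys →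
              (x ∈ xs × y ∈ xs) ⊎ (x ∈ xs × y ∈ ys) ⊎ x ∷ y ∷ [] ⊆ ys
  pair-⊆-++ []       s          = inj₂ (inj₂ s)
  pair-⊆-++ (_ ∷ xs) (_ ∷ʳ s)   =
    Sum.map (λ (x∈ , y∈) → there x∈ , there y∈) (Sum.map₁ (λ (x∈ , y∈) → there x∈ , y∈))
            (pair-⊆-++ xs s)
  pair-⊆-++ (_ ∷ xs) (refl ∷ s) with ∈-++⁻ xs (to∈ s)
  ... | inj₁ y∈xs = inj₁ (here refl , there y∈xs)
  ... | inj₂ y∈ys = inj₂ (inj₁ (here refl , y∈ys))

  pair-⊆-concat : ∀ {x y : A} xss → x ∷ y ∷ [] ⊆ concat xss →
                  (∃ λ xs → xs ∈ xss × x ∈ xs × y ∈ xs) ⊎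
                  (∃₂ λ xs ys → xs ∷ ys ∷ [] ⊆ xss × x ∈ xs × y ∈ ys)
  pair-⊆-concat (xs ∷ xss) s with pair-⊆-++ xs s
  ... | inj₁ (x∈ , y∈) = inj₁ (xs , here refl , x∈ , y∈)
  ... | inj₂ (inj₁ (x∈ , y∈)) with ys , y∈ys , ys∈ ← ∈-concat⁻′ xss y∈ =
    inj₂ (xs , ys , refl ∷ from∈ ys∈ , x∈ , y∈ys)
  ... | inj₂ (inj₂ s′) =
    Sum.map (λ (ys , ys∈ , p) → ys , there ys∈ , p) (λ (ys , zs , s″ , p) → ys , zs , xs ∷ʳ s″ , p)
            (pair-⊆-concat xss s′)

  Unique-++⇒disjoint : ∀ {x : A} xs {ys} → Unique (xs ++ ys) → x ∈ xs → x ∉ ys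
  Unique-++⇒disjoint (_ ∷ xs) (x∉ ∷ _) (here refl) x∈ys = All.lookup x∉ (∈-++⁺ʳ xs x∈ys) refl
  Unique-++⇒disjoint (_ ∷ xs) (_ ∷ u)  (there x∈)  = Unique-++⇒disjoint xs u x∈

  Unique-++⁻ʳ : ∀ (xs : List A) {ys} → Unique (xs ++ ys) → Unique ys
  Unique-++⁻ʳ []       u       = u
  Unique-++⁻ʳ (_ ∷ xs) (_ ∷ u) = Unique-++⁻ʳ xs u

  Unique-concat⇒blocks-disjoint : ∀ {xss : List (List A)} {xs ys x} → Unique (concat xss) →
                                  xs ∈ xss → ys ∈ xss → x ∈ xs → x ∈ ys → xs ≡ ys
  Unique-concat⇒blocks-disjoint           _ (here refl) (here refl) _   _   = refl
  Unique-concat⇒blocks-disjoint {zs ∷ _}  u (here refl) (there ys∈) x∈xs x∈ys =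
    ⊥-elim (Unique-++⇒disjoint zs u x∈xs (∈-concat⁺′ x∈ys ys∈))
  Unique-concat⇒blocks-disjoint {zs ∷ _}  u (there xs∈) (here refl) x∈xs x∈ys =
    ⊥-elim (Unique-++⇒disjoint zs u x∈ys (∈-concat⁺′ x∈xs xs∈))
  Unique-concat⇒blocks-disjoint {zs ∷ _}  u (there xs∈) (there ys∈) x∈xs x∈ys =
    Unique-concat⇒blocks-disjoint (Unique-++⁻ʳ zs u) xs∈ ys∈ x∈xs x∈ys

  concat-reverse-↭ : ∀ (xss : List (List A)) → concat (reverse xss) ↭ concat xss
  concat-reverse-↭ []         = refl
  concat-reverse-↭ (xs ∷ xss) = begin
    concat (reverse (xs ∷ xss))       ≡⟨ cong concat (unfold-reverse xs xss) ⟩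
    concat (reverse xss ++ [ xs ])    ≡⟨ concat-++ (reverse xss) [ xs ] ⟨
    concat (reverse xss) ++ xs ++ []  ≡⟨ cong (concat (reverse xss) ++_) (++-identityʳ xs) ⟩
    concat (reverse xss) ++ xs        ↭⟨ ++-comm (concat (reverse xss)) xs ⟩
    xs ++ concat (reverse xss)        ↭⟨ ++⁺ˡ xs (concat-reverse-↭ xss) ⟩
    xs ++ concat xss                  ∎
    where open PermutationReasoning

  ↭-cancel-prefix : ∀ xs {q ys : List A} → xs ++ q ↭ ys ++ xs → q ↭ ys
  ↭-cancel-prefix []       {ys = ys} p = ↭-trans p (↭-reflexive (++-identityʳ ys))
  ↭-cancel-prefix (x ∷ xs) {ys = ys} p =
    ↭-cancel-prefix xs (drop-∷ (↭-trans p (shift x ys xs)))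

∈-tail-of-↭ : ∀ {n a q x} → a ∷ q ↭ [1‥ n ] → 1 ≤ x → x ≤ n → x ≢ a → x ∈ q
∈-tail-of-↭ q↭ 1≤x x≤n = ∈-tail (∈-resp-↭ (↭-sym q↭) (∈-[1‥]⁺ 1≤x x≤n))

∈-tail-above : ∀ {y ys zs} → All (y <_) zs → All (_∈ y ∷ ys) zs → All (_∈ ys) zs
∈-tail-above y<zs zs∈ = All.zipWith (λ (y<z , z∈) → ∈-tail z∈ (>⇒≢ y<z)) (y<zs , zs∈)

sorted-⊆ : ∀ {xs ys} → AllPairs _<_ xs → AllPairs _<_ ys → All (_∈ ys) xs → xs ⊆ ys
sorted-⊆ {[]}              _          _          _                 = minimum _
sorted-⊆ {_ ∷ _}  {[]}     _          _          (() ∷ _)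
sorted-⊆ {x ∷ xs} {y ∷ ys} (x< ∷ xs<) (_ ∷ ys<)  (here refl ∷ xs∈) =
  refl ∷ sorted-⊆ xs< ys< (∈-tail-above x< xs∈)
sorted-⊆ {x ∷ xs} {y ∷ ys} (x< ∷ xs<) (y< ∷ ys<) (there x∈ ∷ xs∈)  =
  y ∷ʳ sorted-⊆ (x< ∷ xs<) ys< (x∈ ∷ ∈-tail-above (All.map (<-trans (All.lookup y< x∈)) x<) xs∈)

Linked-head-≤ : ∀ {b B} → Linked _<_ (b ∷ B) → All (b ≤_) (b ∷ B)
Linked-head-≤ [-]              = ≤-refl ∷ []
Linked-head-≤ (b<b′ ∷ b′∷B<) = ≤-refl ∷ All.map <⇒≤ (Linked⇒All <-trans b<b′ b′∷B<)

◃-trans : ∀ {B C D} → B ◃ C → C ◃ D → B ◃ D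
◃-trans {_ ∷ _} {_ ∷ _} {_ ∷ _} = <-trans

SameBlock-sym : ∀ {σ x y} → SameBlock σ x y → SameBlock σ y x
SameBlock-sym (B , B∈ , x∈ , y∈) = B , B∈ , y∈ , x∈

SameBlock-sym⇔ : ∀ {σ π x y i j} → SameBlock σ x y ⇔ SameBlock π i j →
                 SameBlock σ y x ⇔ SameBlock π j i
SameBlock-sym⇔ e = mk⇔ (SameBlock-sym ∘ Equivalence.to e ∘ SameBlock-sym)
                       (SameBlock-sym ∘ Equivalence.from e ∘ SameBlock-sym)

module SetPartition {n σ} (isp : IsSetPartition n σ) where
  open IsSetPartition isp

  ordered : AllPairs _◃_ σ
  ordered = Linked⇒AllPairs ◃-trans canonical

  ∈-block⇒∈[1‥] : ∀ {x B} → x ∈ B → B ∈ σ → x ∈ [1‥ n ]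
  ∈-block⇒∈[1‥] x∈B B∈σ = ∈-resp-↭ covers (∈-concat⁺′ x∈B B∈σ)

  SameBlock-refl : ∀ {x} → x ∈ [1‥ n ] → SameBlock σ x x
  SameBlock-refl x∈ with B , x∈B , B∈σ ← ∈-concat⁻′ σ (∈-resp-↭ (↭-sym covers) x∈) =
    B , B∈σ , x∈B , x∈B

  blocks-disjoint : ∀ {B C x} → B ∈ σ → C ∈ σ → x ∈ B → x ∈ C → B ≡ C
  blocks-disjoint = Unique-concat⇒blocks-disjoint (↭-[1‥]⇒Unique covers)

  ¬SameBlock : ∀ {B C x y} → B ∈ σ → C ∈ σ → B ≢ C → x ∈ B → y ∈ C → ¬ SameBlock σ x y
  ¬SameBlock B∈ C∈ B≢C x∈B y∈C (D , D∈ , x∈D , y∈D) =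
    B≢C (trans (blocks-disjoint B∈ D∈ x∈B x∈D) (blocks-disjoint D∈ C∈ y∈D y∈C))

  SameBlock₃ : ∀ {x y z} → SameBlock σ x y → SameBlock σ y z →
               ∃ λ B → B ∈ σ × x ∈ B × y ∈ B × z ∈ B
  SameBlock₃ (B , B∈ , x∈B , y∈B) (C , C∈ , y∈C , z∈C)
    with refl ← blocks-disjoint B∈ C∈ y∈B y∈C = B , B∈ , x∈B , y∈B , z∈C

IsSetPartition-[] : IsSetPartition 0 []
IsSetPartition-[] = record { nonempty = [] ; increasing = [] ; canonical = [] ; covers = refl }

IsSetPartition-∷ʳ : ∀ {m n σ b B} → IsSetPartition m σ → Linked _<_ (b ∷ B) → m < b →
                    [1‥ m ] ++ b ∷ B ≡ [1‥ n ] → IsSetPartition n (σ ++ [ b ∷ B ])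
IsSetPartition-∷ʳ {m} {n} {σ} {b} {B} isp b∷B< m<b extends = record
  { nonempty   = All.++⁺ nonempty ((λ ()) ∷ [])
  ; increasing = All.++⁺ increasing (b∷B< ∷ [])
  ; canonical  = AllPairs⇒Linked
                   (AllPairs.++⁺ ordered ([] ∷ []) (All.tabulate (λ C∈σ → below C∈σ ∷ [])))
  ; covers     = begin
      concat (σ ++ [ b ∷ B ])    ≡⟨ concat-++ σ [ b ∷ B ] ⟨
      concat σ ++ (b ∷ B) ++ []  ≡⟨ cong (concat σ ++_) (++-identityʳ (b ∷ B)) ⟩
      concat σ ++ b ∷ B          ↭⟨ ++⁺ʳ (b ∷ B) covers ⟩
      [1‥ m ] ++ b ∷ B           ≡⟨ extends ⟩
      [1‥ n ]                    ∎
  }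
  where
  open IsSetPartition isp
  open SetPartition isp using (ordered; ∈-block⇒∈[1‥])
  open PermutationReasoning
  below : ∀ {C} → C ∈ σ → C ◃ (b ∷ B)
  below {[]}    C∈σ = All.lookup nonempty C∈σ refl
  below {_ ∷ _} C∈σ = ≤-<-trans (proj₂ (∈-[1‥]⁻ (∈-block⇒∈[1‥] (here refl) C∈σ))) m<b

Φ-∷ʳ : ∀ σ B → Φ (σ ++ [ B ]) ≡ B ++ Φ σ
Φ-∷ʳ σ B = cong concat (reverse-++ σ [ B ])

PContains-triple : ∀ {n σ π a b c} → IsSetPartition n σ → IsSetPartition 3 π →
  a < b → b < c → a ∈ [1‥ n ] → b ∈ [1‥ n ] → c ∈ [1‥ n ] →
  SameBlock σ a b ⇔ SameBlock π 1 2 →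
  SameBlock σ a c ⇔ SameBlock π 1 3 →
  SameBlock σ b c ⇔ SameBlock π 2 3 →
  PContains n σ 3 π
PContains-triple {n} {σ} {π} {a} {b} {c} isp isπ a<b b<c a∈ b∈ c∈ ab ac bc =
  a ∷ b ∷ c ∷ [] , sorted-⊆ abc-sorted ([1‥]-sorted n) (a∈ ∷ b∈ ∷ c∈ ∷ []) , refl , same
  where
  abc-sorted : AllPairs _<_ (a ∷ b ∷ c ∷ [])
  abc-sorted = (a<b ∷ <-trans a<b b<c ∷ []) ∷ (b<c ∷ []) ∷ [] ∷ []
  diagonal : ∀ {x i} → x ∈ [1‥ n ] → i ∈ [1‥ 3 ] → SameBlock σ x x ⇔ SameBlock π i i
  diagonal x∈ i∈ = mk⇔ (const (SetPartition.SameBlock-refl isπ i∈))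
                       (const (SetPartition.SameBlock-refl isp x∈))
  same : ∀ (i j : Fin 3) → SameBlock σ (lookup (a ∷ b ∷ c ∷ []) i) (lookup (a ∷ b ∷ c ∷ []) j)
                         ⇔ SameBlock π (suc (toℕ i)) (suc (toℕ j))
  same zero             zero             = diagonal a∈ (here refl)
  same zero             (suc zero)       = ab
  same zero             (suc (suc zero)) = ac
  same (suc zero)       zero             = SameBlock-sym⇔ ab
  same (suc zero)       (suc zero)       = diagonal b∈ (there (here refl))
  same (suc zero)       (suc (suc zero)) = bc
  same (suc (suc zero)) zero             = SameBlock-sym⇔ ac
  same (suc (suc zero)) (suc zero)       = SameBlock-sym⇔ bc
  same (suc (suc zero)) (suc (suc zero)) = diagonal c∈ (there (there (here refl)))

p13/2-isSetPartition : IsSetPartition 3 p13/2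
p13/2-isSetPartition = record
  { nonempty   = (λ ()) ∷ (λ ()) ∷ []
  ; increasing = (s<s z<s ∷ [-]) ∷ [-] ∷ []
  ; canonical  = s<s z<s ∷ [-]
  ; covers     = prep 1 (swap 3 2 refl)
  }

13/2-joins-1-3 : SameBlock p13/2 1 3
13/2-joins-1-3 = _ , here refl , here refl , there (here refl)

13/2-separates-1-2 : ¬ SameBlock p13/2 1 2
13/2-separates-1-2 = SetPartition.¬SameBlock p13/2-isSetPartition
  (here refl) (there (here refl)) (λ ()) (here refl) (here refl)

13/2-separates-2-3 : ¬ SameBlock p13/2 2 3
13/2-separates-2-3 = SetPartition.¬SameBlock p13/2-isSetPartition
  (there (here refl)) (here refl) (λ ()) (here refl) (there (here refl))

p123ᴾ-isSetPartition : IsSetPartition 3 p123ᴾ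
p123ᴾ-isSetPartition = record
  { nonempty   = (λ ()) ∷ []
  ; increasing = (s<s z<s ∷ s<s (s<s z<s) ∷ [-]) ∷ []
  ; canonical  = [-]
  ; covers     = refl
  }

123ᴾ-joins-1-3 : SameBlock p123ᴾ 1 3
123ᴾ-joins-1-3 = _ , here refl , here refl , there (there (here refl))

SameOrder : ℕ → ℕ → ℕ → ℕ → Set
SameOrder x y u v = (x < y × u < v) ⊎ (y < x × v < u)

OrderIso-triple : ∀ {x y z u v w} → SameOrder x y u v → SameOrder x z u w → SameOrder y z v w →
                  OrderIso (x ∷ y ∷ z ∷ []) (u ∷ v ∷ w ∷ [])
OrderIso-triple xy xz yz = refl , order
  where
  forward : ∀ {x y u v} → SameOrder x y u v → x < y ⇔ u < v
  forward (inj₁ (x<y , u<v)) = mk⇔ (const u<v) (const x<y)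
  forward (inj₂ (y<x , v<u)) = mk⇔ (λ x<y → ⊥-elim (<⇒≱ x<y (<⇒≤ y<x)))
                                   (λ u<v → ⊥-elim (<⇒≱ u<v (<⇒≤ v<u)))
  backward : ∀ {x y u v} → SameOrder x y u v → y < x ⇔ v < u
  backward (inj₁ x<y×u<v) = forward (inj₂ x<y×u<v)
  backward (inj₂ y<x×v<u) = forward (inj₁ y<x×v<u)
  diagonal : ∀ {x u} → x < x ⇔ u < u
  diagonal = mk⇔ (λ x<x → ⊥-elim (<-irrefl refl x<x)) (λ u<u → ⊥-elim (<-irrefl refl u<u))
  order : ∀ (i j : Fin 3) → _
  order zero             zero             = diagonal
  order zero             (suc zero)       = forward xy
  order zero             (suc (suc zero)) = forward xz
  order (suc zero)       zero             = backward xy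
  order (suc zero)       (suc zero)       = diagonal
  order (suc zero)       (suc (suc zero)) = forward yz
  order (suc (suc zero)) zero             = backward xz
  order (suc (suc zero)) (suc zero)       = backward yz
  order (suc (suc zero)) (suc (suc zero)) = diagonal

occurrence : ∀ {q u v w} → Contains q (u ∷ v ∷ w ∷ []) →
             ∃ λ x → ∃₂ λ y z → x ∷ y ∷ z ∷ [] ⊆ q × OrderIso (x ∷ y ∷ z ∷ []) (u ∷ v ∷ w ∷ [])
occurrence (x ∷ y ∷ z ∷ [] , s , iso)        = x , y , z , s , iso
occurrence ([] , _ , () , _)
occurrence (_ ∷ [] , _ , () , _)
occurrence (_ ∷ _ ∷ [] , _ , () , _)
occurrence (_ ∷ _ ∷ _ ∷ _ ∷ _ , _ , () , _)

pattern-order : ∀ {xs ys} → ((eq , _) : OrderIso xs ys) → ∀ i j →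
                lookup ys (cast eq i) < lookup ys (cast eq j) → lookup xs i < lookup xs j
pattern-order (_ , order) i j = Equivalence.from (order i j)

Contains-resp-⊆ : ∀ {q q′ p} → q ⊆ q′ → Contains q p → Contains q′ p
Contains-resp-⊆ q⊆q′ (ys , ys⊆q , iso) = ys , ⊆-trans ys⊆q q⊆q′ , iso

-- Φ maps Π_n(13/2, 123) into S_n(123, 132, 213)

module Φ-avoids {n σ} (isp : IsSetPartition n σ)
                (¬13/2 : ¬ PContains n σ 3 p13/2) (¬123ᴾ : ¬ PContains n σ 3 p123ᴾ) where
  open IsSetPartition isp
  open SetPartition isp

  no-three-in-a-block : ∀ {B a b c} → B ∈ σ → a ∈ B → b ∈ B → c ∈ B → a < b → b < c → ⊥
  no-three-in-a-block {B} B∈ a∈ b∈ c∈ a<b b<c =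
    ¬123ᴾ (PContains-triple isp p123ᴾ-isSetPartition a<b b<c
             (∈-block⇒∈[1‥] a∈ B∈) (∈-block⇒∈[1‥] b∈ B∈) (∈-block⇒∈[1‥] c∈ B∈)
             (both a∈ b∈ (here refl) (there (here refl)))
             (both a∈ c∈ (here refl) (there (there (here refl))))
             (both b∈ c∈ (there (here refl)) (there (there (here refl)))))
    where
    both : ∀ {x y i j} → x ∈ B → y ∈ B → i ∈ 1 ∷ 2 ∷ 3 ∷ [] → j ∈ 1 ∷ 2 ∷ 3 ∷ [] →
           SameBlock σ x y ⇔ SameBlock p123ᴾ i j
    both x∈ y∈ i∈ j∈ = mk⇔ (const (_ , here refl , i∈ , j∈)) (const (B , B∈ , x∈ , y∈))

  ascent-across-blocks : ∀ {B C x y} → C ∈ σ → B ∈ σ → C ◃ B → x ∈ B → y ∈ C → x < y → ⊥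
  ascent-across-blocks {b ∷ B} {c ∷ C} {x} {y} C∈ B∈ c<b x∈B y∈C x<y =
    ¬13/2 (PContains-triple isp p13/2-isSetPartition c<x x<y
             (∈-block⇒∈[1‥] (here refl) C∈) (∈-block⇒∈[1‥] x∈B B∈) (∈-block⇒∈[1‥] y∈C C∈)
             (neither (¬SameBlock C∈ B∈ C≢B (here refl) x∈B) 13/2-separates-1-2)
             (mk⇔ (const 13/2-joins-1-3) (const (_ , C∈ , here refl , y∈C)))
             (neither (¬SameBlock B∈ C∈ (≢-sym C≢B) x∈B y∈C) 13/2-separates-2-3))
    where
    c<x : c < x
    c<x = <-≤-trans c<b (All.lookup (Linked-head-≤ (All.lookup increasing B∈)) x∈B)
    C≢B : c ∷ C ≢ b ∷ B
    C≢B refl = <-irrefl refl c<b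
    neither : ∀ {P Q : Set} → ¬ P → ¬ Q → P ⇔ Q
    neither ¬p ¬q = mk⇔ (⊥-elim ∘ ¬p) (⊥-elim ∘ ¬q)

  ascent⇒SameBlock : ∀ {x y} → x ∷ y ∷ [] ⊆ Φ σ → x < y → SameBlock σ x y
  ascent⇒SameBlock s x<y with pair-⊆-concat (reverse σ) s
  ... | inj₁ (B , B∈ , x∈B , y∈B) = B , reverse⁻ B∈ , x∈B , y∈B
  ... | inj₂ (B , C , BC⊆ , x∈B , y∈C) = ⊥-elim
    (ascent-across-blocks (reverse⁻ (⊆-lookup BC⊆ (there (here refl))))
                          (reverse⁻ (⊆-lookup BC⊆ (here refl)))
                          (AllPairs-pair (AllPairs-reverse ordered) BC⊆) x∈B y∈C x<y)

  module _ {x y z} (s : x ∷ y ∷ z ∷ [] ⊆ Φ σ) where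
    ascent₁₂ : x < y → SameBlock σ x y
    ascent₁₂ = ascent⇒SameBlock (⊆-trans (refl ∷ refl ∷ z ∷ʳ []) s)
    ascent₁₃ : x < z → SameBlock σ x z
    ascent₁₃ = ascent⇒SameBlock (⊆-trans (refl ∷ y ∷ʳ refl ∷ []) s)
    ascent₂₃ : y < z → SameBlock σ y z
    ascent₂₃ = ascent⇒SameBlock (⊆-trans (x ∷ʳ refl ∷ refl ∷ []) s)

  ¬Φ-123 : ¬ Contains (Φ σ) p123
  ¬Φ-123 c with x , y , z , s , iso ← occurrence c
    with x<y ← pattern-order iso zero (suc zero) (s<s z<s)
       | y<z ← pattern-order iso (suc zero) (suc (suc zero)) (s<s (s<s z<s))
    with B , B∈ , x∈ , y∈ , z∈ ← SameBlock₃ (ascent₁₂ s x<y) (ascent₂₃ s y<z)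
    = no-three-in-a-block B∈ x∈ y∈ z∈ x<y y<z

  ¬Φ-132 : ¬ Contains (Φ σ) p132
  ¬Φ-132 c with x , y , z , s , iso ← occurrence c
    with x<z ← pattern-order iso zero (suc (suc zero)) (s<s z<s)
       | z<y ← pattern-order iso (suc (suc zero)) (suc zero) (s<s (s<s z<s))
    with B , B∈ , y∈ , x∈ , z∈ ←
           SameBlock₃ (SameBlock-sym (ascent₁₂ s (<-trans x<z z<y))) (ascent₁₃ s x<z)
    = no-three-in-a-block B∈ x∈ z∈ y∈ x<z z<y

  ¬Φ-213 : ¬ Contains (Φ σ) p213
  ¬Φ-213 c with x , y , z , s , iso ← occurrence c
    with y<x ← pattern-order iso (suc zero) zero (s<s z<s)
       | x<z ← pattern-order iso zero (suc (suc zero)) (s<s (s<s z<s))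
    with B , B∈ , y∈ , z∈ , x∈ ←
           SameBlock₃ (ascent₂₃ s (<-trans y<x x<z)) (SameBlock-sym (ascent₁₃ s x<z))
    = no-three-in-a-block B∈ y∈ x∈ z∈ y<x x<z

  Φ-InS : InS n (Φ σ)
  Φ-InS = ↭-trans (concat-reverse-↭ σ) covers , ¬Φ-123 , ¬Φ-132 , ¬Φ-213

-- Φ is injective on set partitions

++-cancel-at-descent : ∀ {x} B C {u v : List ℕ} → All (x ≤_) B → All (x ≤_) C →
                       Maybe.All (_< x) (head u) → Maybe.All (_< x) (head v) →
                       B ++ u ≡ C ++ v → B ≡ C × u ≡ v
++-cancel-at-descent []      []      _         _         _          _          u≡v  = refl , u≡v
++-cancel-at-descent []      (_ ∷ _) _         (x≤c ∷ _) (just c<x) _          refl =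
  ⊥-elim (<⇒≱ c<x x≤c)
++-cancel-at-descent (_ ∷ _) []      (x≤b ∷ _) _         _          (just b<x) refl =
  ⊥-elim (<⇒≱ b<x x≤b)
++-cancel-at-descent (b ∷ B) (c ∷ C) (_ ∷ x≤B) (_ ∷ x≤C) u<x        v<x        eq
  with refl , eq′ ← ∷-injective eq
  with refl , refl ← ++-cancel-at-descent B C x≤B x≤C u<x v<x eq′ = refl , refl

record DescendingRuns (ρ : List (List ℕ)) : Set where
  field
    nonempty   : All (_≢ []) ρ
    increasing : All (Linked _<_) ρ
    descending : Linked (flip _◃_) ρ

reverse-DescendingRuns : ∀ {n σ} → IsSetPartition n σ → DescendingRuns (reverse σ)
reverse-DescendingRuns isp = record
  { nonempty   = All-reverse nonempty
  ; increasing = All-reverse increasing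
  ; descending = AllPairs⇒Linked (AllPairs-reverse (SetPartition.ordered isp))
  }
  where open IsSetPartition isp

DescendingRuns-tail : ∀ {B ρ} → DescendingRuns (B ∷ ρ) → DescendingRuns ρ
DescendingRuns-tail runs = record
  { nonempty   = All.tail nonempty
  ; increasing = All.tail increasing
  ; descending = Linked.tail descending
  }
  where open DescendingRuns runs

head-run-nonempty : ∀ {B ρ} → DescendingRuns (B ∷ ρ) → B ≢ []
head-run-nonempty runs = All.head (DescendingRuns.nonempty runs)

next-run-below : ∀ {b B ρ} → DescendingRuns ((b ∷ B) ∷ ρ) → Maybe.All (_< b) (head (concat ρ))
next-run-below {ρ = []}          _    = nothing
next-run-below {ρ = [] ∷ _}      runs = ⊥-elim (head-run-nonempty (DescendingRuns-tail runs) refl)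
next-run-below {ρ = (_ ∷ _) ∷ _} runs with c<b ∷ _ ← DescendingRuns.descending runs = just c<b

concat-injective : ∀ {ρ τ} → DescendingRuns ρ → DescendingRuns τ → concat ρ ≡ concat τ → ρ ≡ τ
concat-injective {[]}          {[]}          _     _     _  = refl
concat-injective {[] ∷ _}      {_}           ρruns _     _  = ⊥-elim (head-run-nonempty ρruns refl)
concat-injective {_}           {[] ∷ _}      _     τruns _  = ⊥-elim (head-run-nonempty τruns refl)
concat-injective {[]}          {(_ ∷ _) ∷ _} _     _     ()
concat-injective {(_ ∷ _) ∷ _} {[]}          _     _     ()
concat-injective {(b ∷ B) ∷ ρ} {(c ∷ C) ∷ τ} ρruns τruns eq
  with refl , _ ← ∷-injective eq
  with refl , eq′ ← ++-cancel-at-descent (b ∷ B) (b ∷ C)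
                      (Linked-head-≤ (All.head (DescendingRuns.increasing ρruns)))
                      (Linked-head-≤ (All.head (DescendingRuns.increasing τruns)))
                      (next-run-below ρruns) (next-run-below τruns) eq
  = cong ((b ∷ B) ∷_) (concat-injective (DescendingRuns-tail ρruns) (DescendingRuns-tail τruns) eq′)

Φ-injective : ∀ {m n σ τ} → IsSetPartition m σ → IsSetPartition n τ → Φ σ ≡ Φ τ → σ ≡ τ
Φ-injective iσ iτ eq =
  reverse-injective (concat-injective (reverse-DescendingRuns iσ) (reverse-DescendingRuns iτ) eq)

-- S_n(123, 132, 213) consists of the images of tilings by monominoes and dominoes

data Tile : List ℕ → Set where
  monomino : ∀ k → Tile (k ∷ [])
  domino   : ∀ k → Tile (k ∷ suc k ∷ [])

Tile-increasing : ∀ {b B} → Tile (b ∷ B) → Linked _<_ (b ∷ B)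
Tile-increasing (monomino _) = [-]
Tile-increasing (domino _)   = ≤-refl ∷ [-]

Tile-consecutive : ∀ {B x y} → Tile B → x ∈ B → y ∈ B → x < y → y ≡ suc x
Tile-consecutive (monomino _) (here refl)         (here refl)         k<k   = ⊥-elim (<-irrefl refl k<k)
Tile-consecutive (domino _)   (here refl)         (here refl)         k<k   = ⊥-elim (<-irrefl refl k<k)
Tile-consecutive (domino _)   (here refl)         (there (here refl)) _     = refl
Tile-consecutive (domino _)   (there (here refl)) (here refl)         1+k<k = ⊥-elim (<⇒≱ 1+k<k (n≤1+n _))
Tile-consecutive (domino _)   (there (here refl)) (there (here refl)) k<k   = ⊥-elim (<-irrefl refl k<k)

tiling-avoids : ∀ {n σ π} → All Tile σ → SameBlock π 1 3 → ¬ PContains n σ 3 π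
tiling-avoids tiles π₁₃ (a ∷ b ∷ c ∷ [] , S⊆ , refl , same)
  with (a<b ∷ _) ∷ (b<c ∷ []) ∷ _ ← AllPairs-resp-⊆ S⊆ ([1‥]-sorted _)
     | B , B∈ , a∈B , c∈B ← Equivalence.from (same zero (suc (suc zero))) π₁₃
  with refl ← Tile-consecutive (All.lookup tiles B∈) a∈B c∈B (<-trans a<b b<c)
  = <⇒≱ a<b (m<1+n⇒m≤n b<c)
tiling-avoids _ _ ([] , _ , () , _)
tiling-avoids _ _ (_ ∷ [] , _ , () , _)
tiling-avoids _ _ (_ ∷ _ ∷ [] , _ , () , _)
tiling-avoids _ _ (_ ∷ _ ∷ _ ∷ _ ∷ _ , _ , () , _)

TilingOf : ℕ → List ℕ → Set
TilingOf n q = ∃ λ σ → IsSetPartition n σ × All Tile σ × Φ σ ≡ q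

TilingOf-∷ʳ : ∀ {m n q b B} → TilingOf m q → Tile (b ∷ B) → m < b → [1‥ m ] ++ b ∷ B ≡ [1‥ n ] →
              TilingOf n (b ∷ B ++ q)
TilingOf-∷ʳ {b = b} {B} (σ , isp , tiles , Φσ≡q) tile m<b extends =
  σ ++ [ b ∷ B ] ,
  IsSetPartition-∷ʳ isp (Tile-increasing tile) m<b extends ,
  All.++⁺ tiles (tile ∷ []) ,
  trans (Φ-∷ʳ σ (b ∷ B)) (cong ((b ∷ B) ++_) Φσ≡q)

no-first-letter-below : ∀ {m a q} → a < m → a ∷ q ↭ [1‥ suc m ] →
                        ¬ Contains (a ∷ q) p123 → ¬ Contains (a ∷ q) p132 → ⊥
no-first-letter-below {m} a<m q↭ ¬123 ¬132
  with distinct-∈⇒⊆ (∈-tail-of-↭ q↭ (≤-trans (s≤s z≤n) a<m) (n≤1+n m) (>⇒≢ a<m))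
                    (∈-tail-of-↭ q↭ (s≤s z≤n) ≤-refl (>⇒≢ (m<n⇒m<1+n a<m)))
                    (<⇒≢ (n<1+n m))
... | inj₁ s = ¬123 (_ , refl ∷ s , OrderIso-triple (inj₁ (a<m , s<s z<s))
                                                    (inj₁ (m<n⇒m<1+n a<m , s<s z<s))
                                                    (inj₁ (n<1+n m , s<s (s<s z<s))))
... | inj₂ s = ¬132 (_ , refl ∷ s , OrderIso-triple (inj₁ (m<n⇒m<1+n a<m , s<s z<s))
                                                    (inj₁ (a<m , s<s z<s))
                                                    (inj₂ (n<1+n m , s<s (s<s z<s))))

first-letter-top-two : ∀ {n a q} → a ∷ q ↭ [1‥ n ] →
                       ¬ Contains (a ∷ q) p123 → ¬ Contains (a ∷ q) p132 → a ≡ n ⊎ suc a ≡ n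
first-letter-top-two q↭ ¬123 ¬132 with m≤n⇒m<n∨m≡n (proj₂ (∈-[1‥]⁻ (∈-resp-↭ q↭ (here refl))))
... | inj₂ a≡n = inj₁ a≡n
... | inj₁ a<n with m≤n⇒m<n∨m≡n a<n
...   | inj₂ 1+a≡n     = inj₂ 1+a≡n
...   | inj₁ (s≤s a<m) = ⊥-elim (no-first-letter-below a<m q↭ ¬123 ¬132)

second-letter-top : ∀ {k q} → suc k ∷ q ↭ [1‥ suc (suc k) ] → ¬ Contains (suc k ∷ q) p213 →
                    ∃ λ q′ → q ≡ suc (suc k) ∷ q′
second-letter-top {k} {[]}    q↭ _ with () ← ↭-length q↭
second-letter-top {k} {b ∷ q} q↭ ¬213 with b ≟ suc (suc k)
... | yes refl = q , refl
... | no b≢top = ⊥-elim (¬213 (_ , refl ∷ refl ∷ from∈ top∈q ,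
                                 OrderIso-triple (inj₂ (b<1+k , s<s z<s))
                                                 (inj₁ (n<1+n (suc k) , s<s (s<s z<s)))
                                                 (inj₁ (m<n⇒m<1+n b<1+k , s<s z<s))))
  where
  top∈q : suc (suc k) ∈ q
  top∈q = ∈-tail (∈-tail-of-↭ q↭ (s≤s z≤n) ≤-refl (>⇒≢ (n<1+n (suc k)))) (≢-sym b≢top)
  b≤1+k : b ≤ suc k
  b≤1+k = m<1+n⇒m≤n (≤∧≢⇒< (proj₂ (∈-[1‥]⁻ (∈-resp-↭ q↭ (there (here refl))))) b≢top)
  b<1+k : b < suc k
  b<1+k with (1+k≢b ∷ _) ∷ _ ← ↭-[1‥]⇒Unique q↭ = ≤∧≢⇒< b≤1+k (≢-sym 1+k≢b)

data TopTile : ℕ → List ℕ → Set where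
  top-monomino : ∀ {m q} → q ↭ [1‥ m ] → TopTile (suc m) (suc m ∷ q)
  top-domino   : ∀ {k q} → q ↭ [1‥ k ] → TopTile (suc (suc k)) (suc k ∷ suc (suc k) ∷ q)

topTile : ∀ {m q} → InS (suc m) q → TopTile (suc m) q
topTile {m} {[]}    (q↭ , _) with () ← ↭-length q↭
topTile {m} {a ∷ q} (q↭ , ¬123 , ¬132 , ¬213) with first-letter-top-two q↭ ¬123 ¬132
... | inj₁ refl =
  top-monomino (↭-cancel-prefix [ suc m ] (subst (suc m ∷ q ↭_) ([1‥]-∷ʳ m) q↭))
topTile {_} {zero ∷ q}  (q↭ , _) | inj₂ refl
  with () ← proj₁ (∈-[1‥]⁻ (∈-resp-↭ q↭ (here refl)))
topTile {_} {suc k ∷ q} (q↭ , _ , _ , ¬213) | inj₂ refl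
  with q′ , refl ← second-letter-top q↭ ¬213 =
  top-domino (↭-cancel-prefix (suc k ∷ suc (suc k) ∷ [])
               (subst (suc k ∷ suc (suc k) ∷ q′ ↭_) (sym ([1‥]-++-pair k)) q↭))

InS-⊆ : ∀ {m n q q′} → q′ ⊆ q → q′ ↭ [1‥ m ] → InS n q → InS m q′
InS-⊆ q′⊆q q′↭ (_ , ¬123 , ¬132 , ¬213) =
  q′↭ , ¬123 ∘ Contains-resp-⊆ q′⊆q , ¬132 ∘ Contains-resp-⊆ q′⊆q , ¬213 ∘ Contains-resp-⊆ q′⊆q

tiling : ∀ n q → InS n q → TilingOf n q
tiling zero    q (q↭[] , _) = [] , IsSetPartition-[] , [] , sym (↭-empty-inv q↭[])
tiling (suc m) q q∈S with topTile q∈S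
... | top-monomino {q = q′} q′↭ =
  TilingOf-∷ʳ (tiling m q′ (InS-⊆ (_ ∷ʳ ⊆-refl) q′↭ q∈S)) (monomino (suc m)) ≤-refl
              (sym ([1‥]-∷ʳ m))
... | top-domino {k} {q″} q″↭ =
  TilingOf-∷ʳ (tiling k q″ (InS-⊆ (_ ∷ʳ _ ∷ʳ ⊆-refl) q″↭ q∈S)) (domino (suc k)) ≤-refl
              ([1‥]-++-pair k)

proposition2p13 : ∀ (n : ℕ) → 1 ≤ n →
    (∀ σ → InΠ n σ → InS n (Φ σ))
    × (∀ σ τ → InΠ n σ → InΠ n τ → Φ σ ≡ Φ τ → σ ≡ τ)
    × (∀ q → InS n q → Σ (List (List ℕ)) λ σ → InΠ n σ × Φ σ ≡ q)
proposition2p13 n _ =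
  (λ σ (isp , ¬13/2 , ¬123ᴾ) → Φ-avoids.Φ-InS isp ¬13/2 ¬123ᴾ) ,
  (λ σ τ (iσ , _) (iτ , _) → Φ-injective iσ iτ) ,
  (λ q q∈S → let σ , isp , tiles , Φσ≡q = tiling n q q∈S in
     σ , (isp , tiling-avoids tiles 13/2-joins-1-3 , tiling-avoids tiles 123ᴾ-joins-1-3) , Φσ≡q)
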